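{- Let $G$ be a graph, $X\subseteq V(G)$ and $A\subseteq E(G)$ with $|A|\ge |E(G)|-1$. Then $\iota(G_A)\ge \iota(G[X]_A)$.
   Context: For $D\subseteq V(H)$, $N[D]$ is $D$ with all neighbours; $D$ is an isolating set of $H$ if $H-N[D]$ has no edges; $\iota(H)$ is the minimum size of an isolating set. For a graph $H$ and a set $A$ of edges, $H_A$ denotes the graph obtained from $H$ by subdividing exactly once each edge of $A$ that lies in $H$. $G[X]$ is the subgraph induced by $X$, so $G[X]_A$ is obtained from $G[X]$ by subdividing the edges of $A\cap E(G[X])$. -}

module Defs where

open import Data.Bool using (Bool; true; false; _∧_; _∨_; not; if_then_else_)
open import Data.Nat using (ℕ; _<ᵇ_; _≤_; _+_)
open import Data.Fin using (Fin; toℕ; splitAt)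
open import Data.Fin.Properties using (_≟_)
open import Data.Fin.Subset using (Subset; _∈_; _∉_; ∣_∣)
open import Data.List using (List; filterᵇ; cartesianProduct; length; lookup; allFin)
open import Data.Product using (_×_; _,_; Σ; ∃-syntax)
open import Data.Sum using (inj₁; inj₂)
open import Data.Vec using (Vec)
open import Relation.Nullary.Decidable using (⌊_⌋)
open import Relation.Binary.PropositionalEquality using (_≡_)

-- An edge {i,j} (i ≠ j) is encoded by the ordered pair (i , j) with
-- toℕ i < toℕ j; the Boolean  E i j  says whether {i,j} is an edge.
-- Entries E i j with toℕ i ≥ toℕ j are ignored, so every record value
-- is a simple (loopless, undirected, no multi-edges) graph.

record Graph : Set where
  field
    n : ℕ
    E : Fin n → Fin n → Bool
open Graph public

lt : ∀ {n} → Fin n → Fin n → Bool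
lt i j = toℕ i <ᵇ toℕ j

eqᵇ : ∀ {n} → Fin n → Fin n → Bool
eqᵇ i j = ⌊ i ≟ j ⌋

symm : ∀ {n} → (Fin n → Fin n → Bool) → Fin n → Fin n → Bool
symm R i j = (lt i j ∧ R i j) ∨ (lt j i ∧ R j i)

adj : (H : Graph) → Fin (n H) → Fin (n H) → Bool
adj H = symm (E H)

pairs : (n : ℕ) → List (Fin n × Fin n)
pairs n = cartesianProduct (allFin n) (allFin n)

edges : (H : Graph) → List (Fin (n H) × Fin (n H))
edges H = filterᵇ (λ { (i , j) → lt i j ∧ E H i j }) (pairs (n H))

numEdges : Graph → ℕ
numEdges H = length (edges H)

-- Edge sets of a graph G are Boolean relations A on Fin (n G), where the
-- pair (i , j) with i < j stands for {i , j} (other entries ignored).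

EdgeSet : Graph → Set
EdgeSet G = Fin (n G) → Fin (n G) → Bool

EdgesOf : (G : Graph) → EdgeSet G → Set
EdgesOf G A = ∀ i j → lt i j ≡ true → A i j ≡ true → E G i j ≡ true

card : ∀ {n} → (Fin n → Fin n → Bool) → ℕ
card {n} A = length (filterᵇ (λ { (i , j) → lt i j ∧ A i j }) (pairs n))

-- Subdivision H_R: subdivide exactly once every edge of H lying in R.
-- R is given as a Boolean relation on the vertices of H (read for i < j).
-- New vertex set: Fin (n H + m), where the last m vertices are the
-- subdivision vertices, one for each edge of H in R.

subEdges : (H : Graph) → (Fin (n H) → Fin (n H) → Bool) → List (Fin (n H) × Fin (n H))
subEdges H R = filterᵇ (λ { (i , j) → lt i j ∧ E H i j ∧ R i j }) (pairs (n H))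

subdivAdj : (H : Graph) (R : Fin (n H) → Fin (n H) → Bool) →
            Fin (n H + length (subEdges H R)) → Fin (n H + length (subEdges H R)) → Bool
subdivAdj H R a b with splitAt (n H) a | splitAt (n H) b
... | inj₁ u | inj₁ v = adj H u v ∧ not (symm R u v)
... | inj₁ u | inj₂ k with lookup (subEdges H R) k
...   | (i , j) = eqᵇ u i ∨ eqᵇ u j
subdivAdj H R a b | inj₂ k | inj₁ v with lookup (subEdges H R) k
...   | (i , j) = eqᵇ v i ∨ eqᵇ v j
subdivAdj H R a b | inj₂ _ | inj₂ _ = false

subdivide : (H : Graph) → (Fin (n H) → Fin (n H) → Bool) → Graph
subdivide H R = record { n = n H + length (subEdges H R) ; E = subdivAdj H R }

-- Induced subgraph G[X]; its vertices Fin k correspond to the elements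
-- of X (listed in increasing order) via the embedding  emb.

elems : ∀ {n} → Subset n → List (Fin n)
elems {n} X = filterᵇ (λ i → ⌊ Data.Fin.Subset.Properties._∈?_ i X ⌋) (allFin n)
  where import Data.Fin.Subset.Properties

emb : ∀ {n} (X : Subset n) → Fin (length (elems X)) → Fin n
emb X = lookup (elems X)

induced : (G : Graph) → Subset (n G) → Graph
induced G X = record { n = length (elems X) ; E = λ a b → adj G (emb X a) (emb X b) }

restrictEdges : (G : Graph) (X : Subset (n G)) → EdgeSet G →
                Fin (length (elems X)) → Fin (length (elems X)) → Bool
restrictEdges G X A a b = symm A (emb X a) (emb X b)

InClosedNbhd : (H : Graph) → Subset (n H) → Fin (n H) → Set
InClosedNbhd H D v = v ∈ D ⊎' (∃[ u ] (u ∈ D × adj H u v ≡ true))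
  where open import Data.Sum renaming (_⊎_ to _⊎'_)

IsIsolating : (H : Graph) → Subset (n H) → Set
IsIsolating H D = ∀ u v → adj H u v ≡ true →
  ¬' InClosedNbhd H D u → ¬' InClosedNbhd H D v → ⊥'
  where open import Relation.Nullary renaming (¬_ to ¬'_)
        open import Data.Empty renaming (⊥ to ⊥')

IotaIs : Graph → ℕ → Set
IotaIs H k = (Σ (Subset (n H)) λ D → IsIsolating H D × ∣ D ∣ ≡ k)
           × (∀ D → IsIsolating H D → k ≤ ∣ D ∣)

{-# OPTIONS --safe #-}
module Submission where

-- Map G[X]_A into G_A by ψ, sending a vertex of X to itself and the subdivision vertex
-- of an edge ab of G[X] to that of ab in G_A; ψ preserves adjacency.  Every vertex d of
-- G_A has a replacement x in G[X]_A such that y ∈ N[x] whenever ψ y ∈ N[d]: a vertex of X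
-- is replaced by itself, a subdivision vertex by the subdivision vertex of the same edge
-- or by its unique end in X, and a vertex d ∉ X by the other end of an unsubdivided edge
-- from d into X (if there is one).  That end is unique because |A| ≥ |E(G)| − 1 leaves at
-- most one edge of G unsubdivided.  Replacing each vertex of an isolating set D of G_A gives a set of size
-- at most |D| isolating G[X]_A: an edge of G[X]_A outside its closed neighbourhood would
-- be mapped by ψ to an edge of G_A outside N[D].

open import Defs
open import Data.Bool using (Bool; true; false; _∧_; _∨_; not; T?)
open import Data.Bool.Properties
  using (∨-comm; ∨-identityʳ; ∨-zeroʳ; ∧-conicalˡ; ∧-conicalʳ; not-injective; ¬-not; not-¬; T-≡)
  renaming (_≟_ to _≟ᵇ_)
open import Data.Empty using (⊥-elim)
open import Data.Fin using (Fin; zero; suc; toℕ; splitAt; join)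
open import Data.Fin.Properties using (toℕ-injective; splitAt-join; join-splitAt; any?; all?) renaming (_≟_ to _≟ᶠ_)
open import Data.Fin.Subset using (Subset; _∈_; _∉_; ∣_∣; _∪_; ⁅_⁆; inside; outside) renaming (⊥ to ∅)
open import Data.Fin.Subset.Properties using (_∈?_; x∈⁅x⁆; x∈p∪q⁺; ∣⁅x⁆∣≡1; ∣⊥∣≡0)
open import Data.List using (List; []; _∷_; length; lookup; allFin; filterᵇ)
open import Data.List.Membership.Propositional using () renaming (_∈_ to _∈ˡ_)
open import Data.List.Membership.Propositional.Properties
  using (∈-allFin; ∈-cartesianProduct⁺; ∈-lookup; ∈-filter⁻; ∈-filter⁺)
open import Data.List.Relation.Unary.All as All using ()
open import Data.List.Relation.Unary.AllPairs using (_∷_)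
open import Data.List.Relation.Unary.Any using (here; there; index)
open import Data.List.Relation.Unary.Any.Properties using (lookup-index)
open import Data.List.Relation.Unary.Unique.Propositional using (Unique)
open import Data.List.Relation.Unary.Unique.Propositional.Properties using (filter⁺; cartesianProduct⁺; allFin⁺)
open import Data.Maybe as Maybe using (Maybe; just; nothing; maybe′)
open import Data.Nat using (ℕ; suc; _≤_; _<_; _+_; z≤n; s≤s)
open import Data.Nat.Properties
  using (<ᵇ⇒<; <⇒<ᵇ; <-irrefl; <-asym; <-cmp; +-suc; +-mono-≤; +-cancelˡ-≤; ≤-trans; ≤-reflexive; m≤n⇒m≤1+n)
open import Data.Product using (_×_; _,_; proj₁; proj₂; ∃; uncurry)
open import Data.Sum as Sum using (_⊎_; inj₁; inj₂; swap)
open import Data.Sum.Properties using (inj₁-injective)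
open import Data.Vec using ([]; _∷_; here; there)
open import Function using (_∘_; id; _⇔_; mk⇔; Equivalence)
open import Relation.Binary.Definitions using (tri<; tri≈; tri>)
open import Relation.Binary.PropositionalEquality
  using (_≡_; _≢_; refl; sym; trans; cong; cong₂; subst; subst₂; module ≡-Reasoning)
open import Relation.Nullary using (¬_; Dec; yes; no)
open import Relation.Nullary.Decidable using (⌊_⌋; toWitness; fromWitness; dec⇒maybe; _⊎-dec_; _→-dec_)

open Equivalence using (to; from)

∨-true : ∀ {a b} → a ∨ b ≡ true → a ≡ true ⊎ b ≡ true
∨-true {true}  _ = inj₁ refl
∨-true {false} e = inj₂ e

lt⇒< : ∀ {N} (i j : Fin N) → lt i j ≡ true → toℕ i < toℕ j
lt⇒< i j i<j = <ᵇ⇒< (toℕ i) (toℕ j) (from T-≡ i<j)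

<⇒lt : ∀ {N} (i j : Fin N) → toℕ i < toℕ j → lt i j ≡ true
<⇒lt i j i<j = to T-≡ (<⇒<ᵇ i<j)

lt-irrefl : ∀ {N} (i : Fin N) → lt i i ≡ false
lt-irrefl i = ¬-not (<-irrefl refl ∘ lt⇒< i i)

lt-asym : ∀ {N} (i j : Fin N) → lt i j ≡ true → lt j i ≡ false
lt-asym i j i<j = ¬-not (<-asym (lt⇒< i j i<j) ∘ lt⇒< j i)

lt-connex : ∀ {N} (i j : Fin N) → i ≢ j → lt i j ≡ true ⊎ lt j i ≡ true
lt-connex i j i≢j with <-cmp (toℕ i) (toℕ j)
... | tri< i<j _ _ = inj₁ (<⇒lt i j i<j)
... | tri≈ _ i≡j _ = ⊥-elim (i≢j (toℕ-injective i≡j))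
... | tri> _ _ j<i = inj₂ (<⇒lt j i j<i)

eqᵇ⇒≡ : ∀ {N} (u i : Fin N) → eqᵇ u i ≡ true → u ≡ i
eqᵇ⇒≡ u i u≡i = toWitness {a? = u ≟ᶠ i} (from T-≡ u≡i)

≡⇒eqᵇ : ∀ {N} (u i : Fin N) → u ≡ i → eqᵇ u i ≡ true
≡⇒eqᵇ u i u≡i = to T-≡ (fromWitness {a? = u ≟ᶠ i} u≡i)

infix 4 _∈ₚ_

_∈ₚ_ : ∀ {B : Set} → B → B × B → Set
u ∈ₚ p = u ≡ proj₁ p ⊎ u ≡ proj₂ p

eqᵇ-∨⇔∈ₚ : ∀ {N} (u : Fin N) (p : Fin N × Fin N) → (eqᵇ u (proj₁ p) ∨ eqᵇ u (proj₂ p)) ≡ true ⇔ u ∈ₚ p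
eqᵇ-∨⇔∈ₚ u (i , j) = mk⇔ to′ from′
  where
  to′ : (eqᵇ u i ∨ eqᵇ u j) ≡ true → u ∈ₚ (i , j)
  to′ e with ∨-true {eqᵇ u i} e
  ... | inj₁ u≡i = inj₁ (eqᵇ⇒≡ u i u≡i)
  ... | inj₂ u≡j = inj₂ (eqᵇ⇒≡ u j u≡j)
  from′ : u ∈ₚ (i , j) → (eqᵇ u i ∨ eqᵇ u j) ≡ true
  from′ (inj₁ u≡i) rewrite ≡⇒eqᵇ u i u≡i = refl
  from′ (inj₂ u≡j) rewrite ≡⇒eqᵇ u j u≡j = ∨-zeroʳ (eqᵇ u i)

∈ₚ-of-distinct : ∀ {B : Set} {u v w : B} {p : B × B} →
                 u ≢ v → u ∈ₚ p → v ∈ₚ p → w ∈ₚ p → w ∈ₚ (u , v)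
∈ₚ-of-distinct u≢v (inj₁ refl) (inj₁ refl) _   = ⊥-elim (u≢v refl)
∈ₚ-of-distinct u≢v (inj₁ refl) (inj₂ refl) w∈p = w∈p
∈ₚ-of-distinct u≢v (inj₂ refl) (inj₁ refl) w∈p = swap w∈p
∈ₚ-of-distinct u≢v (inj₂ refl) (inj₂ refl) _   = ⊥-elim (u≢v refl)

Sorted : ∀ {N} → Fin N × Fin N → Set
Sorted (i , j) = lt i j ≡ true

sorted-≡ : ∀ {N} {p q : Fin N × Fin N} → Sorted p → Sorted q → proj₁ p ∈ₚ q → proj₂ p ∈ₚ q → p ≡ q
sorted-≡ {q = k , _} p↑ _  (inj₁ refl) (inj₁ refl) = ⊥-elim (not-¬ (lt-irrefl k) p↑)
sorted-≡             _  _  (inj₁ refl) (inj₂ refl) = refl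
sorted-≡ {q = k , l} p↑ q↑ (inj₂ refl) (inj₁ refl) = ⊥-elim (not-¬ (lt-asym k l q↑) p↑)
sorted-≡ {q = _ , l} p↑ _  (inj₂ refl) (inj₂ refl) = ⊥-elim (not-¬ (lt-irrefl l) p↑)

module _ {N} (F : Fin N → Fin N → Bool) where

  symm-comm : ∀ i j → symm F i j ≡ symm F j i
  symm-comm i j = ∨-comm (lt i j ∧ F i j) (lt j i ∧ F j i)

  symm-irrefl : ∀ i → symm F i i ≡ false
  symm-irrefl i rewrite lt-irrefl i = refl

  symm-true⇒≢ : ∀ {u v} → symm F u v ≡ true → u ≢ v
  symm-true⇒≢ {u} uv refl = not-¬ (symm-irrefl u) uv

  symm-sorted : ∀ i j → lt i j ≡ true → symm F i j ≡ F i j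
  symm-sorted i j i<j rewrite i<j | lt-asym i j i<j = ∨-identityʳ (F i j)

  symm-of-symmetric : (∀ i j → F i j ≡ F j i) → (∀ i → F i i ≡ false) → ∀ i j → symm F i j ≡ F i j
  symm-of-symmetric F-sym F-irrefl i j with i ≟ᶠ j
  ... | yes refl = trans (symm-irrefl i) (sym (F-irrefl i))
  ... | no i≢j with lt-connex i j i≢j
  ...   | inj₁ i<j = symm-sorted i j i<j
  ...   | inj₂ j<i = trans (symm-comm i j) (trans (symm-sorted j i j<i) (F-sym j i))

  symm-at-ends : ∀ {u v} {p : Fin N × Fin N} → Sorted p → u ≢ v → u ∈ₚ p → v ∈ₚ p →
                 symm F u v ≡ uncurry F p
  symm-at-ends {p = i , j} p↑ _   (inj₁ refl) (inj₂ refl) = symm-sorted i j p↑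
  symm-at-ends {p = i , j} p↑ _   (inj₂ refl) (inj₁ refl) = trans (symm-comm j i) (symm-sorted i j p↑)
  symm-at-ends             _  u≢v (inj₁ refl) (inj₁ refl) = ⊥-elim (u≢v refl)
  symm-at-ends             _  u≢v (inj₂ refl) (inj₂ refl) = ⊥-elim (u≢v refl)

  symm-true⇒sorted : ∀ {u v} → symm F u v ≡ true →
                     ∃ λ p → Sorted p × uncurry F p ≡ true × u ∈ₚ p × v ∈ₚ p
  symm-true⇒sorted {u} {v} uv with lt-connex u v (symm-true⇒≢ uv)
  ... | inj₁ u<v = (u , v) , u<v , trans (sym (symm-sorted u v u<v)) uv , inj₁ refl , inj₂ refl
  ... | inj₂ v<u = (v , u) , v<u , trans (sym (symm-sorted v u v<u)) (trans (symm-comm v u) uv) ,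
                   inj₂ refl , inj₁ refl

module _ {B : Set} where

  length-filterᵇ-split : (p q : B → Bool) → (∀ x → q x ≡ true → p x ≡ true) → ∀ xs →
    length (filterᵇ p xs) ≡ length (filterᵇ q xs) + length (filterᵇ (λ x → p x ∧ not (q x)) xs)
  length-filterᵇ-split p q q⇒p [] = refl
  length-filterᵇ-split p q q⇒p (x ∷ xs) with q x in qx
  ... | true rewrite q⇒p x qx = cong suc (length-filterᵇ-split p q q⇒p xs)
  ... | false with p x
  ...   | true  = trans (cong suc (length-filterᵇ-split p q q⇒p xs)) (sym (+-suc _ _))
  ...   | false = length-filterᵇ-split p q q⇒p xs

  ∈-filterᵇ⁺ : ∀ (p : B → Bool) {x xs} → x ∈ˡ xs → p x ≡ true → x ∈ˡ filterᵇ p xs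
  ∈-filterᵇ⁺ p x∈xs px = ∈-filter⁺ (T? ∘ p) x∈xs (from T-≡ px)

  lookup-filterᵇ : ∀ (p : B → Bool) xs k → p (lookup (filterᵇ p xs) k) ≡ true
  lookup-filterᵇ p xs k = to T-≡ (proj₂ (∈-filter⁻ (T? ∘ p) {xs = xs} (∈-lookup k)))

  ∈-length≤1⇒≡ : ∀ {x y} {xs : List B} → length xs ≤ 1 → x ∈ˡ xs → y ∈ˡ xs → x ≡ y
  ∈-length≤1⇒≡ {xs = _ ∷ []}    _ (here refl) (here refl) = refl
  ∈-length≤1⇒≡ {xs = _ ∷ _ ∷ _} (s≤s ()) _ _

  lookup-injective : ∀ {xs : List B} → Unique xs → ∀ i j → lookup xs i ≡ lookup xs j → i ≡ j
  lookup-injective (_ ∷ _)    zero    zero    _  = refl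
  lookup-injective (x≢ ∷ _)   zero    (suc j) eq = ⊥-elim (All.lookup x≢ (∈-lookup j) eq)
  lookup-injective (x≢ ∷ _)   (suc i) zero    eq = ⊥-elim (All.lookup x≢ (∈-lookup i) (sym eq))
  lookup-injective (_ ∷ uniq) (suc i) (suc j) eq = cong suc (lookup-injective uniq i j eq)

∣p∪q∣≤∣p∣+∣q∣ : ∀ {M} (p q : Subset M) → ∣ p ∪ q ∣ ≤ ∣ p ∣ + ∣ q ∣
∣p∪q∣≤∣p∣+∣q∣ []            []           = z≤n
∣p∪q∣≤∣p∣+∣q∣ (outside ∷ p) (outside ∷ q) = ∣p∪q∣≤∣p∣+∣q∣ p q
∣p∪q∣≤∣p∣+∣q∣ (inside ∷ p)  (outside ∷ q) = s≤s (∣p∪q∣≤∣p∣+∣q∣ p q)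
∣p∪q∣≤∣p∣+∣q∣ (outside ∷ p) (inside ∷ q) rewrite +-suc ∣ p ∣ ∣ q ∣ = s≤s (∣p∪q∣≤∣p∣+∣q∣ p q)
∣p∪q∣≤∣p∣+∣q∣ (inside ∷ p)  (inside ∷ q) rewrite +-suc ∣ p ∣ ∣ q ∣ = s≤s (m≤n⇒m≤1+n (∣p∪q∣≤∣p∣+∣q∣ p q))

fromMaybe : ∀ {M} → Maybe (Fin M) → Subset M
fromMaybe = maybe′ ⁅_⁆ ∅

∣fromMaybe∣≤1 : ∀ {M} (x : Maybe (Fin M)) → ∣ fromMaybe x ∣ ≤ 1
∣fromMaybe∣≤1     (just x) = ≤-reflexive (∣⁅x⁆∣≡1 x)
∣fromMaybe∣≤1 {M} nothing  = ≤-trans (≤-reflexive (∣⊥∣≡0 M)) z≤n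

image : ∀ {N M} → (Fin N → Maybe (Fin M)) → Subset N → Subset M
image f []            = ∅
image f (outside ∷ D) = image (f ∘ suc) D
image f (inside ∷ D)  = fromMaybe (f zero) ∪ image (f ∘ suc) D

∈-image : ∀ {N M} (f : Fin N → Maybe (Fin M)) {D d x} → d ∈ D → f d ≡ just x → x ∈ image f D
∈-image f {inside ∷ D}  {zero}  here        fd≡x rewrite fd≡x = x∈p∪q⁺ (inj₁ (x∈⁅x⁆ _))
∈-image f {outside ∷ D} {suc d} (there d∈D) fd≡x = ∈-image (f ∘ suc) d∈D fd≡x
∈-image f {inside ∷ D}  {suc d} (there d∈D) fd≡x = x∈p∪q⁺ (inj₂ (∈-image (f ∘ suc) d∈D fd≡x))

∣image∣≤ : ∀ {N M} (f : Fin N → Maybe (Fin M)) D → ∣ image f D ∣ ≤ ∣ D ∣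
∣image∣≤ {M = M} f [] = ≤-reflexive (∣⊥∣≡0 M)
∣image∣≤ f (outside ∷ D) = ∣image∣≤ (f ∘ suc) D
∣image∣≤ f (inside ∷ D) = ≤-trans (∣p∪q∣≤∣p∣+∣q∣ (fromMaybe (f zero)) (image (f ∘ suc) D))
                                  (+-mono-≤ (∣fromMaybe∣≤1 (f zero)) (∣image∣≤ (f ∘ suc) D))

Dominates : (H : Graph) → Fin (n H) → Fin (n H) → Set
Dominates H u v = u ≡ v ⊎ adj H u v ≡ true

dominates? : (H : Graph) → ∀ u v → Dec (Dominates H u v)
dominates? H u v = (u ≟ᶠ v) ⊎-dec (adj H u v ≟ᵇ true)

dominates⇒InClosedNbhd : ∀ H {D u v} → u ∈ D → Dominates H u v → InClosedNbhd H D v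
dominates⇒InClosedNbhd _ u∈D (inj₁ refl) = inj₁ u∈D
dominates⇒InClosedNbhd _ u∈D (inj₂ uv)   = inj₂ (_ , u∈D , uv)

choose : ∀ {M} {P : Fin M → Set} → Dec (∃ P) → Maybe (Fin M)
choose = Maybe.map proj₁ ∘ dec⇒maybe

choose-complete : ∀ {M} {P : Fin M → Set} (P? : Dec (∃ P)) → ∃ P → ∃ λ x → choose P? ≡ just x × P x
choose-complete (yes (x , px)) _ = x , refl , px
choose-complete (no ¬p)        p = ⊥-elim (¬p p)

module _ (H H′ : Graph) (ψ : Fin (n H′) → Fin (n H)) where

  ReplacedBy : Fin (n H) → Fin (n H′) → Set
  ReplacedBy d x = ∀ y → Dominates H d (ψ y) → Dominates H′ x y

  isolating-transfer :
    (∀ x y → adj H′ x y ≡ true → adj H (ψ x) (ψ y) ≡ true) →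
    (∀ d y → Dominates H d (ψ y) → ∃ (ReplacedBy d)) →
    ∀ D → IsIsolating H D → ∃ λ D′ → IsIsolating H′ D′ × ∣ D′ ∣ ≤ ∣ D ∣
  isolating-transfer ψ-adj replace D D-isolating = D′ , D′-isolating , ∣image∣≤ pick D
    where
    pick : Fin (n H) → Maybe (Fin (n H′))
    pick d = choose (any? λ x → all? λ y → dominates? H d (ψ y) →-dec dominates? H′ x y)

    D′ : Subset (n H′)
    D′ = image pick D

    undominated : ∀ y → ¬ InClosedNbhd H′ D′ y → ¬ InClosedNbhd H D (ψ y)
    undominated y y∉N[D′] ψy∈N[D] = y∉N[D′] (dominated ψy∈N[D])
      where
      via : ∀ {d} → d ∈ D → Dominates H d (ψ y) → InClosedNbhd H′ D′ y
      via {d} d∈D dψy with choose-complete (any? _) (replace d y dψy)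
      ... | x , picked , replaced = dominates⇒InClosedNbhd H′ (∈-image pick d∈D picked) (replaced y dψy)
      dominated : InClosedNbhd H D (ψ y) → InClosedNbhd H′ D′ y
      dominated (inj₁ ψy∈D)            = via ψy∈D (inj₁ refl)
      dominated (inj₂ (d , d∈D , dψy)) = via d∈D (inj₂ dψy)

    D′-isolating : IsIsolating H′ D′
    D′-isolating u v uv u∉ v∉ = D-isolating (ψ u) (ψ v) (ψ-adj u v uv) (undominated u u∉) (undominated v v∉)

ι-mono : ∀ (H H′ : Graph) →
         (∀ D → IsIsolating H D → ∃ λ D′ → IsIsolating H′ D′ × ∣ D′ ∣ ≤ ∣ D ∣) →
         ∀ {a b} → IotaIs H a → IotaIs H′ b → b ≤ a
ι-mono H H′ transfer ((D , D-isolating , ∣D∣≡a) , _) (_ , b-minimal) with transfer D D-isolating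
... | D′ , D′-isolating , ∣D′∣≤∣D∣ =
  ≤-trans (b-minimal D′ D′-isolating) (≤-trans ∣D′∣≤∣D∣ (≤-reflexive ∣D∣≡a))

module Subdivision (H : Graph) (R : Fin (n H) → Fin (n H) → Bool) where

  m : ℕ
  m = length (subEdges H R)

  ends : Fin m → Fin (n H) × Fin (n H)
  ends = lookup (subEdges H R)

  IsEnd : Fin m → Fin (n H) → Set
  IsEnd k u = u ∈ₚ ends k

  private
    ends-filtered : ∀ k → let (i , j) = ends k in lt i j ∧ E H i j ∧ R i j ≡ true
    ends-filtered = lookup-filterᵇ _ (pairs (n H))

  ends-sorted : ∀ k → Sorted (ends k)
  ends-sorted k = ∧-conicalˡ _ _ (ends-filtered k)

  ends-edge : ∀ k → uncurry (E H) (ends k) ≡ true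
  ends-edge k = ∧-conicalˡ _ (uncurry R (ends k)) (∧-conicalʳ (uncurry lt (ends k)) _ (ends-filtered k))

  ends-in-R : ∀ k → uncurry R (ends k) ≡ true
  ends-in-R k = ∧-conicalʳ (uncurry (E H) (ends k)) _ (∧-conicalʳ (uncurry lt (ends k)) _ (ends-filtered k))

  ends-adj : ∀ k → uncurry (adj H) (ends k) ≡ true
  ends-adj k = trans (symm-sorted (E H) _ _ (ends-sorted k)) (ends-edge k)

  ends-symm-R : ∀ k → uncurry (symm R) (ends k) ≡ true
  ends-symm-R k = trans (symm-sorted R _ _ (ends-sorted k)) (ends-in-R k)

  ends-injective : ∀ {k l} → ends k ≡ ends l → k ≡ l
  ends-injective = lookup-injective (filter⁺ _ (cartesianProduct⁺ (allFin⁺ (n H)) (allFin⁺ (n H)))) _ _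

  same-ends⇒≡ : ∀ {k l} → IsEnd l (proj₁ (ends k)) → IsEnd l (proj₂ (ends k)) → k ≡ l
  same-ends⇒≡ {k} {l} i∈l j∈l = ends-injective (sorted-≡ (ends-sorted k) (ends-sorted l) i∈l j∈l)

  subdivision-vertex : ∀ {u v} → adj H u v ≡ true → symm R u v ≡ true → ∃ λ k → IsEnd k u × IsEnd k v
  subdivision-vertex {u} {v} uv uv∈R with symm-true⇒sorted (E H) uv
  ... | (i , j) , i<j , ij , u∈ , v∈ = index ij∈ , subst (u ∈ₚ_) ij≡ u∈ , subst (v ∈ₚ_) ij≡ v∈
    where
    ij∈R : R i j ≡ true
    ij∈R = trans (sym (symm-at-ends R i<j (symm-true⇒≢ (E H) uv) u∈ v∈)) uv∈R
    filtered : lt i j ∧ E H i j ∧ R i j ≡ true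
    filtered rewrite i<j | ij | ij∈R = refl
    ij∈ : (i , j) ∈ˡ subEdges H R
    ij∈ = ∈-filterᵇ⁺ _ (∈-cartesianProduct⁺ (∈-allFin i) (∈-allFin j)) filtered
    ij≡ : (i , j) ≡ ends (index ij∈)
    ij≡ = lookup-index ij∈

  Vertex : Set
  Vertex = Fin (n H) ⊎ Fin m

  adjᵛ : Vertex → Vertex → Bool
  adjᵛ (inj₁ u) (inj₁ v) = adj H u v ∧ not (symm R u v)
  adjᵛ (inj₁ u) (inj₂ k) = eqᵇ u (proj₁ (ends k)) ∨ eqᵇ u (proj₂ (ends k))
  adjᵛ (inj₂ k) (inj₁ u) = adjᵛ (inj₁ u) (inj₂ k)
  adjᵛ (inj₂ _) (inj₂ _) = false

  adjᵛ-end : ∀ k u → adjᵛ (inj₁ u) (inj₂ k) ≡ true ⇔ IsEnd k u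
  adjᵛ-end k u = eqᵇ-∨⇔∈ₚ u (ends k)

  private
    subdivAdj≡adjᵛ : ∀ a b → subdivAdj H R a b ≡ adjᵛ (splitAt (n H) a) (splitAt (n H) b)
    subdivAdj≡adjᵛ a b with splitAt (n H) a | splitAt (n H) b
    ... | inj₁ u | inj₁ v = refl
    ... | inj₁ u | inj₂ k = refl
    ... | inj₂ k | inj₁ v = refl
    ... | inj₂ k | inj₂ l = refl

    adjᵛ-sym : ∀ ξ η → adjᵛ ξ η ≡ adjᵛ η ξ
    adjᵛ-sym (inj₁ u) (inj₁ v) rewrite symm-comm (E H) u v | symm-comm R u v = refl
    adjᵛ-sym (inj₁ u) (inj₂ k) = refl
    adjᵛ-sym (inj₂ k) (inj₁ u) = refl
    adjᵛ-sym (inj₂ k) (inj₂ l) = refl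

    adjᵛ-irrefl : ∀ ξ → adjᵛ ξ ξ ≡ false
    adjᵛ-irrefl (inj₁ u) rewrite symm-irrefl (E H) u = refl
    adjᵛ-irrefl (inj₂ k) = refl

  adj-subdivide : ∀ a b → adj (subdivide H R) a b ≡ adjᵛ (splitAt (n H) a) (splitAt (n H) b)
  adj-subdivide a b = trans (symm-of-symmetric (subdivAdj H R) sym′ irrefl′ a b) (subdivAdj≡adjᵛ a b)
    where
    sym′ : ∀ a b → subdivAdj H R a b ≡ subdivAdj H R b a
    sym′ a b = trans (subdivAdj≡adjᵛ a b)
                     (trans (adjᵛ-sym (splitAt (n H) a) (splitAt (n H) b)) (sym (subdivAdj≡adjᵛ b a)))
    irrefl′ : ∀ a → subdivAdj H R a a ≡ false
    irrefl′ a = trans (subdivAdj≡adjᵛ a a) (adjᵛ-irrefl (splitAt (n H) a))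

  Dominatesᵛ : Vertex → Vertex → Set
  Dominatesᵛ ξ η = ξ ≡ η ⊎ adjᵛ ξ η ≡ true

  dominates-subdivide : ∀ a b → Dominates (subdivide H R) a b ⇔ Dominatesᵛ (splitAt (n H) a) (splitAt (n H) b)
  dominates-subdivide a b = mk⇔ to′ from′
    where
    to′ : Dominates (subdivide H R) a b → Dominatesᵛ (splitAt (n H) a) (splitAt (n H) b)
    to′ (inj₁ a≡b) = inj₁ (cong (splitAt (n H)) a≡b)
    to′ (inj₂ ab)  = inj₂ (trans (sym (adj-subdivide a b)) ab)
    from′ : Dominatesᵛ (splitAt (n H) a) (splitAt (n H) b) → Dominates (subdivide H R) a b
    from′ (inj₁ a≡b) =
      inj₁ (trans (sym (join-splitAt (n H) m a)) (trans (cong (join (n H) m) a≡b) (join-splitAt (n H) m b)))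
    from′ (inj₂ ab) = inj₂ (trans (adj-subdivide a b) ab)

  dominatesᵛ-orig-orig : ∀ {u v} → Dominatesᵛ (inj₁ u) (inj₁ v) →
                         u ≡ v ⊎ (adj H u v ≡ true × symm R u v ≡ false)
  dominatesᵛ-orig-orig (inj₁ refl) = inj₁ refl
  dominatesᵛ-orig-orig {u} {v} (inj₂ uv) =
    inj₂ (∧-conicalˡ (adj H u v) _ uv , not-injective (∧-conicalʳ (adj H u v) _ uv))

  dominatesᵛ-orig-sub : ∀ {u k} → Dominatesᵛ (inj₁ u) (inj₂ k) → IsEnd k u
  dominatesᵛ-orig-sub {u} {k} (inj₂ uk) = to (adjᵛ-end k u) uk

  dominatesᵛ-sub-orig : ∀ {k u} → Dominatesᵛ (inj₂ k) (inj₁ u) → IsEnd k u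
  dominatesᵛ-sub-orig {k} {u} (inj₂ ku) = to (adjᵛ-end k u) ku

  dominatesᵛ-sub-sub : ∀ {k l} → Dominatesᵛ (inj₂ k) (inj₂ l) → k ≡ l
  dominatesᵛ-sub-sub (inj₁ refl) = refl

module _ (G : Graph) (X : Subset (n G)) where

  emb-∈ : ∀ a → emb X a ∈ X
  emb-∈ a = toWitness (proj₂ (∈-filter⁻ (T? ∘ (λ i → ⌊ i ∈? X ⌋)) {xs = allFin (n G)} (∈-lookup a)))

  emb-surjective : ∀ {v} → v ∈ X → ∃ λ a → emb X a ≡ v
  emb-surjective {v} v∈X = index v∈elems , sym (lookup-index v∈elems)
    where
    v∈elems : v ∈ˡ elems X
    v∈elems = ∈-filter⁺ (T? ∘ (λ i → ⌊ i ∈? X ⌋)) (∈-allFin v) (fromWitness v∈X)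

  emb-injective : ∀ a b → emb X a ≡ emb X b → a ≡ b
  emb-injective = lookup-injective (filter⁺ _ (allFin⁺ (n G)))

  adj-induced : ∀ a b → adj (induced G X) a b ≡ adj G (emb X a) (emb X b)
  adj-induced = symm-of-symmetric _ (λ a b → symm-comm (E G) (emb X a) (emb X b)) (symm-irrefl (E G) ∘ emb X)

  symm-restrictEdges : ∀ (A : EdgeSet G) a b → symm (restrictEdges G X A) a b ≡ symm A (emb X a) (emb X b)
  symm-restrictEdges A = symm-of-symmetric _ (λ a b → symm-comm A (emb X a) (emb X b)) (symm-irrefl A ∘ emb X)

module _ (G : Graph) (A : EdgeSet G) (A⊆E : EdgesOf G A) (E≤A+1 : numEdges G ≤ card A + 1) where

  private
    IsEdge IsInA : Fin (n G) × Fin (n G) → Bool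
    IsEdge (i , j) = lt i j ∧ E G i j
    IsInA  (i , j) = lt i j ∧ A i j

    unsubdividedEdges : List (Fin (n G) × Fin (n G))
    unsubdividedEdges = filterᵇ (λ s → IsEdge s ∧ not (IsInA s)) (pairs (n G))

    inA⇒edge : ∀ s → IsInA s ≡ true → IsEdge s ≡ true
    inA⇒edge (i , j) ij∈A
      rewrite ∧-conicalˡ (lt i j) _ ij∈A | A⊆E i j (∧-conicalˡ (lt i j) _ ij∈A) (∧-conicalʳ (lt i j) _ ij∈A) = refl

    at-most-one : length unsubdividedEdges ≤ 1
    at-most-one = +-cancelˡ-≤ (card A) _ _ (≤-trans (≤-reflexive (sym split)) E≤A+1)
      where
      split : numEdges G ≡ card A + length unsubdividedEdges
      split = length-filterᵇ-split IsEdge IsInA inA⇒edge (pairs (n G))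

    unsubdivided-sorted : ∀ {u v} → adj G u v ≡ true → symm A u v ≡ false →
                          ∃ λ s → s ∈ˡ unsubdividedEdges × u ∈ₚ s × v ∈ₚ s
    unsubdivided-sorted uv uv∉A with symm-true⇒sorted (E G) uv
    ... | (i , j) , i<j , ij , u∈ , v∈ =
      (i , j) , ∈-filterᵇ⁺ _ (∈-cartesianProduct⁺ (∈-allFin i) (∈-allFin j)) filtered , u∈ , v∈
      where
      ij∉A : A i j ≡ false
      ij∉A = trans (sym (symm-at-ends A i<j (symm-true⇒≢ (E G) uv) u∈ v∈)) uv∉A
      filtered : IsEdge (i , j) ∧ not (IsInA (i , j)) ≡ true
      filtered rewrite i<j | ij | ij∉A = refl

  unsubdivided-unique : ∀ v p q → adj G v p ≡ true × symm A v p ≡ false →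
                        adj G v q ≡ true × symm A v q ≡ false → p ≡ q
  unsubdivided-unique v p q (vp , vp∉A) (vq , vq∉A) with unsubdivided-sorted vp vp∉A | unsubdivided-sorted vq vq∉A
  ... | s , s∈ , v∈s , p∈s | t , t∈ , v∈t , q∈t with ∈-length≤1⇒≡ at-most-one s∈ t∈
  ...   | refl with ∈ₚ-of-distinct (symm-true⇒≢ (E G) vq) v∈t q∈t p∈s
  ...     | inj₁ p≡v = ⊥-elim (symm-true⇒≢ (E G) vp (sym p≡v))
  ...     | inj₂ p≡q = p≡q

module Embedding (G : Graph) (X : Subset (n G)) (A : EdgeSet G)
                 (A⊆E : EdgesOf G A) (E≤A+1 : numEdges G ≤ card A + 1) where

  module S = Subdivision G A
  module S′ = Subdivision (induced G X) (restrictEdges G X A)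

  H H′ : Graph
  H = subdivide G A
  H′ = subdivide (induced G X) (restrictEdges G X A)

  private
    e : Fin (n (induced G X)) → Fin (n G)
    e = emb X

    emb≡⇒∈X : ∀ c {v} → e c ≡ v → v ∈ X
    emb≡⇒∈X c ec≡v = subst (_∈ X) ec≡v (emb-∈ G X c)

    split : Fin (n H) → S.Vertex
    split = splitAt (n G)

    split′ : Fin (n H′) → S′.Vertex
    split′ = splitAt (n (induced G X))

    -- S′.ends-edge and S′.ends-in-R state, by definition of induced and restrictEdges,
    -- that the ends of k′ are joined in G by an edge of A.
    lifted : ∀ k′ → ∃ λ k → S.IsEnd k (e (proj₁ (S′.ends k′))) × S.IsEnd k (e (proj₂ (S′.ends k′)))
    lifted k′ = S.subdivision-vertex (S′.ends-edge k′) (S′.ends-in-R k′)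

    emb-ends-distinct : ∀ k′ → e (proj₁ (S′.ends k′)) ≢ e (proj₂ (S′.ends k′))
    emb-ends-distinct k′ = symm-true⇒≢ (E G) {e (proj₁ (S′.ends k′))} {e (proj₂ (S′.ends k′))} (S′.ends-edge k′)

  lift : Fin S′.m → Fin S.m
  lift = proj₁ ∘ lifted

  lift-end⁺ : ∀ k′ {a} → S′.IsEnd k′ a → S.IsEnd (lift k′) (e a)
  lift-end⁺ k′ (inj₁ refl) = proj₁ (proj₂ (lifted k′))
  lift-end⁺ k′ (inj₂ refl) = proj₂ (proj₂ (lifted k′))

  lift-end⁻ : ∀ k′ {v} → S.IsEnd (lift k′) v → ∃ λ a → v ≡ e a × S′.IsEnd k′ a
  lift-end⁻ k′ v∈ = Sum.[ (λ v≡ea → _ , v≡ea , inj₁ refl) , (λ v≡eb → _ , v≡eb , inj₂ refl) ]′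
    (∈ₚ-of-distinct (emb-ends-distinct k′) (lift-end⁺ k′ (inj₁ refl)) (lift-end⁺ k′ (inj₂ refl)) v∈)

  lift-end∈X : ∀ k′ {v} → S.IsEnd (lift k′) v → v ∈ X
  lift-end∈X k′ v∈ = let a , v≡ea , _ = lift-end⁻ k′ v∈ in emb≡⇒∈X a (sym v≡ea)

  lift-end-emb : ∀ k′ a → S.IsEnd (lift k′) (e a) → S′.IsEnd k′ a
  lift-end-emb k′ a ea∈ =
    let a′ , ea≡ea′ , a′∈ = lift-end⁻ k′ ea∈ in subst (S′.IsEnd k′) (sym (emb-injective G X a a′ ea≡ea′)) a′∈

  ψᵛ : S′.Vertex → S.Vertex
  ψᵛ = Sum.map e lift

  adjᵛ-emb : ∀ a b → S′.adjᵛ (inj₁ a) (inj₁ b) ≡ S.adjᵛ (inj₁ (e a)) (inj₁ (e b))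
  adjᵛ-emb a b = cong₂ (λ x y → x ∧ not y) (adj-induced G X a b) (symm-restrictEdges G X A a b)

  ψᵛ-adj : ∀ ξ η → S′.adjᵛ ξ η ≡ true → S.adjᵛ (ψᵛ ξ) (ψᵛ η) ≡ true
  ψᵛ-adj (inj₁ a)  (inj₁ b)  ab  = trans (sym (adjᵛ-emb a b)) ab
  ψᵛ-adj (inj₁ a)  (inj₂ k′) ak′ = from (S.adjᵛ-end (lift k′) (e a)) (lift-end⁺ k′ (to (S′.adjᵛ-end k′ a) ak′))
  ψᵛ-adj (inj₂ k′) (inj₁ a)  ak′ = from (S.adjᵛ-end (lift k′) (e a)) (lift-end⁺ k′ (to (S′.adjᵛ-end k′ a) ak′))

  ReplacedByᵛ : S.Vertex → S′.Vertex → Set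
  ReplacedByᵛ δ ξ = ∀ η → S.Dominatesᵛ δ (ψᵛ η) → S′.Dominatesᵛ ξ η

  replace-emb : ∀ a → ReplacedByᵛ (inj₁ (e a)) (inj₁ a)
  replace-emb a (inj₁ b) (inj₁ ea≡eb) = inj₁ (cong inj₁ (emb-injective G X a b (inj₁-injective ea≡eb)))
  replace-emb a (inj₁ b) (inj₂ ab) = inj₂ (trans (adjᵛ-emb a b) ab)
  replace-emb a (inj₂ k′) ak′ = inj₂ (from (S′.adjᵛ-end k′ a) (lift-end-emb k′ a (S.dominatesᵛ-orig-sub ak′)))

  replace-inside : ∀ {v} → v ∈ X → ∃ (ReplacedByᵛ (inj₁ v))
  replace-inside v∈X = let a , ea≡v = emb-surjective G X v∈X in
    inj₁ a , subst (λ v → ReplacedByᵛ (inj₁ v) (inj₁ a)) ea≡v (replace-emb a)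

  outside-¬dominates-lift : ∀ {v} → v ∉ X → ∀ k′ → ¬ S.Dominatesᵛ (inj₁ v) (inj₂ (lift k′))
  outside-¬dominates-lift v∉X k′ vk′ = v∉X (lift-end∈X k′ (S.dominatesᵛ-orig-sub vk′))

  outside-dominates⇒unsubdivided : ∀ {v} → v ∉ X → ∀ a → S.Dominatesᵛ (inj₁ v) (inj₁ (e a)) →
                                   adj G v (e a) ≡ true × symm A v (e a) ≡ false
  outside-dominates⇒unsubdivided v∉X a va =
    Sum.[ (λ v≡ea → ⊥-elim (v∉X (emb≡⇒∈X a (sym v≡ea)))) , id ]′ (S.dominatesᵛ-orig-orig va)

  replace-outside : ∀ {v} → v ∉ X → ∀ η → S.Dominatesᵛ (inj₁ v) (ψᵛ η) → ∃ (ReplacedByᵛ (inj₁ v))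
  replace-outside {v} v∉X (inj₁ a) va = inj₁ a , replaced
    where
    replaced : ReplacedByᵛ (inj₁ v) (inj₁ a)
    replaced (inj₁ b) vb = inj₁ (cong inj₁ (emb-injective G X a b
      (unsubdivided-unique G A A⊆E E≤A+1 v (e a) (e b)
        (outside-dominates⇒unsubdivided v∉X a va) (outside-dominates⇒unsubdivided v∉X b vb))))
    replaced (inj₂ k′) vk′ = ⊥-elim (outside-¬dominates-lift v∉X k′ vk′)
  replace-outside v∉X (inj₂ k′) vk′ = ⊥-elim (outside-¬dominates-lift v∉X k′ vk′)

  lower : ∀ k → proj₁ (S.ends k) ∈ X → proj₂ (S.ends k) ∈ X →
          ∃ λ k″ → ∀ c → S.IsEnd k (e c) → S′.IsEnd k″ c
  lower k i∈X j∈X = k″ , lower-end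
    where
    a b : Fin (n (induced G X))
    a = proj₁ (emb-surjective G X i∈X)
    b = proj₁ (emb-surjective G X j∈X)
    ea≡i : e a ≡ proj₁ (S.ends k)
    ea≡i = proj₂ (emb-surjective G X i∈X)
    eb≡j : e b ≡ proj₂ (S.ends k)
    eb≡j = proj₂ (emb-surjective G X j∈X)
    ab-edge : adj (induced G X) a b ≡ true
    ab-edge = trans (adj-induced G X a b)
                    (subst₂ (λ u v → adj G u v ≡ true) (sym ea≡i) (sym eb≡j) (S.ends-adj k))
    ab∈R : symm (restrictEdges G X A) a b ≡ true
    ab∈R = trans (symm-restrictEdges G X A a b)
                 (subst₂ (λ u v → symm A u v ≡ true) (sym ea≡i) (sym eb≡j) (S.ends-symm-R k))
    lowered : ∃ λ k″ → S′.IsEnd k″ a × S′.IsEnd k″ b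
    lowered = S′.subdivision-vertex {a} {b} ab-edge ab∈R
    k″ : Fin S′.m
    k″ = proj₁ lowered
    lower-end : ∀ c → S.IsEnd k (e c) → S′.IsEnd k″ c
    lower-end c (inj₁ ec≡i) =
      subst (S′.IsEnd k″) (emb-injective G X a c (trans ea≡i (sym ec≡i))) (proj₁ (proj₂ lowered))
    lower-end c (inj₂ ec≡j) =
      subst (S′.IsEnd k″) (emb-injective G X b c (trans eb≡j (sym ec≡j))) (proj₂ (proj₂ lowered))

  lift-dominated : ∀ {k} k′ → S.Dominatesᵛ (inj₂ k) (inj₂ (lift k′)) → ∀ {v} → S′.IsEnd k′ v → S.IsEnd k (e v)
  lift-dominated k′ kk′ v∈ = subst (λ l → S.IsEnd l _) (sym (S.dominatesᵛ-sub-sub kk′)) (lift-end⁺ k′ v∈)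

  replace-lowered : ∀ k k″ → (∀ c → S.IsEnd k (e c) → S′.IsEnd k″ c) → ReplacedByᵛ (inj₂ k) (inj₂ k″)
  replace-lowered k k″ lower-end (inj₁ c) kc =
    inj₂ (from (S′.adjᵛ-end k″ c) (lower-end c (S.dominatesᵛ-sub-orig kc)))
  replace-lowered k k″ lower-end (inj₂ k′) kk′ = inj₁ (cong inj₂ (sym (S′.same-ends⇒≡
    (lower-end _ (lift-dominated k′ kk′ (inj₁ refl))) (lower-end _ (lift-dominated k′ kk′ (inj₂ refl))))))

  replace-by-end : ∀ k a {w} → S.IsEnd k (e a) → S.IsEnd k w → w ∉ X → ReplacedByᵛ (inj₂ k) (inj₁ a)
  replace-by-end k a {w} ea∈k w∈k w∉X (inj₁ c) kc =
    Sum.[ (λ ec≡ea → inj₁ (cong inj₁ (emb-injective G X a c (sym ec≡ea))))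
        , (λ ec≡w → ⊥-elim (w∉X (emb≡⇒∈X c ec≡w))) ]′
      (∈ₚ-of-distinct (w∉X ∘ emb≡⇒∈X a) ea∈k w∈k (S.dominatesᵛ-sub-orig kc))
  replace-by-end k a {w} ea∈k w∈k w∉X (inj₂ k′) kk′ =
    ⊥-elim (w∉X (lift-end∈X k′ (subst (λ l → S.IsEnd l w) (S.dominatesᵛ-sub-sub kk′) w∈k)))

  outside-subdivision-dominates-nothing : ∀ k → proj₁ (S.ends k) ∉ X → proj₂ (S.ends k) ∉ X →
                                          ∀ η → ¬ S.Dominatesᵛ (inj₂ k) (ψᵛ η)
  outside-subdivision-dominates-nothing k i∉X j∉X (inj₁ c) kc =
    Sum.[ i∉X ∘ emb≡⇒∈X c , j∉X ∘ emb≡⇒∈X c ]′ (S.dominatesᵛ-sub-orig kc)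
  outside-subdivision-dominates-nothing k i∉X j∉X (inj₂ k′) kk′ =
    i∉X (lift-end∈X k′ (subst (λ l → S.IsEnd l (proj₁ (S.ends k))) (S.dominatesᵛ-sub-sub kk′) (inj₁ refl)))

  replace-original : ∀ {v} → Dec (v ∈ X) → ∀ η → S.Dominatesᵛ (inj₁ v) (ψᵛ η) → ∃ (ReplacedByᵛ (inj₁ v))
  replace-original (yes v∈X) _ _ = replace-inside v∈X
  replace-original (no v∉X)      = replace-outside v∉X

  replace-subdivision : ∀ k → Dec (proj₁ (S.ends k) ∈ X) → Dec (proj₂ (S.ends k) ∈ X) →
                        ∀ η → S.Dominatesᵛ (inj₂ k) (ψᵛ η) → ∃ (ReplacedByᵛ (inj₂ k))
  replace-subdivision k (yes i∈X) (yes j∈X) _ _ =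
    let k″ , lower-end = lower k i∈X j∈X in inj₂ k″ , replace-lowered k k″ lower-end
  replace-subdivision k (yes i∈X) (no j∉X) _ _ =
    let a , ea≡i = emb-surjective G X i∈X in inj₁ a , replace-by-end k a (inj₁ ea≡i) (inj₂ refl) j∉X
  replace-subdivision k (no i∉X) (yes j∈X) _ _ =
    let b , eb≡j = emb-surjective G X j∈X in inj₁ b , replace-by-end k b (inj₂ eb≡j) (inj₁ refl) i∉X
  replace-subdivision k (no i∉X) (no j∉X) η kη =
    ⊥-elim (outside-subdivision-dominates-nothing k i∉X j∉X η kη)

  replaceᵛ : ∀ δ η → S.Dominatesᵛ δ (ψᵛ η) → ∃ (ReplacedByᵛ δ)
  replaceᵛ (inj₁ v) = replace-original (v ∈? X)
  replaceᵛ (inj₂ k) = replace-subdivision k (proj₁ (S.ends k) ∈? X) (proj₂ (S.ends k) ∈? X)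

  ψ : Fin (n H′) → Fin (n H)
  ψ y = join (n G) S.m (ψᵛ (split′ y))

  split-ψ : ∀ y → split (ψ y) ≡ ψᵛ (split′ y)
  split-ψ y = splitAt-join (n G) S.m (ψᵛ (split′ y))

  ψ-adj : ∀ x y → adj H′ x y ≡ true → adj H (ψ x) (ψ y) ≡ true
  ψ-adj x y xy = begin
    adj H (ψ x) (ψ y)                      ≡⟨ S.adj-subdivide (ψ x) (ψ y) ⟩
    S.adjᵛ (split (ψ x)) (split (ψ y))     ≡⟨ cong₂ S.adjᵛ (split-ψ x) (split-ψ y) ⟩
    S.adjᵛ (ψᵛ (split′ x)) (ψᵛ (split′ y)) ≡⟨ ψᵛ-adj (split′ x) (split′ y) (trans (sym (S′.adj-subdivide x y)) xy) ⟩
    true                                   ∎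
    where open ≡-Reasoning

  dominates-ψ : ∀ d y → Dominates H d (ψ y) → S.Dominatesᵛ (split d) (ψᵛ (split′ y))
  dominates-ψ d y dψy = subst (S.Dominatesᵛ (split d)) (split-ψ y) (to (S.dominates-subdivide d (ψ y)) dψy)

  replace : ∀ d y → Dominates H d (ψ y) → ∃ (ReplacedBy H H′ ψ d)
  replace d y dψy = x , x-replaces
    where
    replacedᵛ : ∃ (ReplacedByᵛ (split d))
    replacedᵛ = replaceᵛ (split d) (split′ y) (dominates-ψ d y dψy)
    x : Fin (n H′)
    x = join (n (induced G X)) S′.m (proj₁ replacedᵛ)
    split′-x : split′ x ≡ proj₁ replacedᵛ
    split′-x = splitAt-join (n (induced G X)) S′.m (proj₁ replacedᵛ)
    x-replaces : ReplacedBy H H′ ψ d x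
    x-replaces y′ dψy′ = from (S′.dominates-subdivide x y′)
      (subst (λ ζ → S′.Dominatesᵛ ζ (split′ y′)) (sym split′-x) (proj₂ replacedᵛ (split′ y′) (dominates-ψ d y′ dψy′)))

lemma3p5 : (G : Graph) (X : Subset (n G)) (A : EdgeSet G) →
    EdgesOf G A → numEdges G ≤ card A + 1 →
    (a b : ℕ) → IotaIs (subdivide G A) a →
    IotaIs (subdivide (induced G X) (restrictEdges G X A)) b →
    b ≤ a
lemma3p5 G X A A⊆E E≤A+1 _ _ = ι-mono H H′ (isolating-transfer H H′ ψ ψ-adj replace)
  where open Embedding G X A A⊆E E≤A+1
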